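{- Let $r \geq 3$ be a fixed integer and let $P$ be a pairing chosen uniformly at random from $P_{n,r}$. If $E_0 \subset [n]^{(2)}$ is a fixed set of $m \leq \frac{nr}{4}$ pairs of vertices, then $$\Pr\left(E_0 \subset E(G(P))\right) \leq 2\left(\frac{2r}{n}\right)^{m}.$$
   Context: Pairing (configuration) model: for $rn$ even, take $rn$ points partitioned into $n$ cells $v_1, \dots, v_n$, each containing $r$ points. $P_{n,r}$ is the set of perfect matchings (pairings) of these $rn$ points. A pairing $P$ induces a multigraph $G(P)$ on $[n]$ whose vertices are the cells and whose edges correspond to the pairs of $P$ (a pair joins the cells containing its two points). $[n]^{(2)}$ denotes the set of 2-element subsets of $[n]$. Here $n \to \infty$. -}

module Defs where

open import Data.Nat using (ℕ; zero; suc)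
open import Data.Fin using (Fin; _≟_)
open import Data.Fin.Properties using (all?; any?)
open import Data.Product using (_×_; _,_; proj₁; ∃)
open import Data.Product.Properties using (≡-dec)
open import Data.List using (List; []; _∷_; length; filter; map; concatMap; cartesianProduct; allFin)
open import Data.List.Relation.Unary.All using (All) renaming (all? to allL?)
open import Data.Vec using (Vec; []; _∷_; lookup)
open import Relation.Binary.PropositionalEquality using (_≡_)
open import Relation.Nullary using (¬_; Dec)
open import Relation.Nullary.Decidable using (_×-dec_; ¬?)

-- The r·n points of the configuration model: point (v , j) is the j-th point of cell v.
Point : ℕ → ℕ → Set
Point n r = Fin n × Fin r

Table : ℕ → ℕ → Set
Table n r = Vec (Vec (Point n r) r) n

app : ∀ {n r} → Table n r → Point n r → Point n r
app t (v , j) = lookup (lookup t v) j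

-- A pairing (perfect matching of the points) = fixed-point-free involution:
-- each point p is paired with app t p.
IsPairing : ∀ {n r} → Table n r → Set
IsPairing {n} {r} t = ∀ (v : Fin n) (j : Fin r) →
  (app t (app t (v , j)) ≡ (v , j)) × ¬ (app t (v , j) ≡ (v , j))

HasEdge : ∀ {n r} → Table n r → Fin n × Fin n → Set
HasEdge {n} {r} t (u , v) = ∃ λ (j : Fin r) → proj₁ (app t (u , j)) ≡ v

Contains : ∀ {n r} → List (Fin n × Fin n) → Table n r → Set
Contains E0 t = All (HasEdge t) E0

_≟P_ : ∀ {n r} (p q : Point n r) → Dec (p ≡ q)
_≟P_ = ≡-dec _≟_ _≟_

isPairing? : ∀ {n r} (t : Table n r) → Dec (IsPairing t)
isPairing? t = all? λ v → all? λ j →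
  (app t (app t (v , j)) ≟P (v , j)) ×-dec ¬? (app t (v , j) ≟P (v , j))

hasEdge? : ∀ {n r} (t : Table n r) (e : Fin n × Fin n) → Dec (HasEdge t e)
hasEdge? t (u , v) = any? λ j → proj₁ (app t (u , j)) ≟ v

contains? : ∀ {n r} (E0 : List (Fin n × Fin n)) (t : Table n r) → Dec (Contains E0 t)
contains? E0 t = allL? (hasEdge? t) E0

pairingAndContains? : ∀ {n r} (E0 : List (Fin n × Fin n)) (t : Table n r) →
  Dec (IsPairing t × Contains E0 t)
pairingAndContains? E0 t = isPairing? t ×-dec contains? E0 t

allVec : ∀ {A : Set} → List A → (k : ℕ) → List (Vec A k)
allVec xs zero = [] ∷ []
allVec xs (suc k) = concatMap (λ x → map (x ∷_) (allVec xs k)) xs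

allPoints : (n r : ℕ) → List (Point n r)
allPoints n r = cartesianProduct (allFin n) (allFin r)

allTables : (n r : ℕ) → List (Table n r)
allTables n r = allVec (allVec (allPoints n r) r) n

numPairings : (n r : ℕ) → ℕ
numPairings n r = length (filter isPairing? (allTables n r))

numPairingsContaining : (n r : ℕ) → List (Fin n × Fin n) → ℕ
numPairingsContaining n r E0 = length (filter (pairingAndContains? E0) (allTables n r))

-- Requiring the edge {u, v} means choosing one of the r² point pairs (u, j), (v, j′) to realise
-- it, so it suffices that each further prescribed pair {p, q} costs a factor rn/2. Let c be the
-- pairs prescribed so far. If q already occurs in c the count is 0. Otherwise, for every point k
-- outside p and the 2|c| points of c, conjugating by the transposition (q k) maps the pairings
-- with p ↦ q injectively to those with p ↦ k; the latter families are disjoint, so the pairings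
-- with p ↦ q make up at most a 1/(rn − 2|c| − 1) ≤ 2/(rn) fraction of those satisfying c.
-- Hence the probability is at most (r² · 2/(rn))^m = (2r/n)^m, without the factor 2 and
-- without using that rn is even.
module Submission where

open import Data.Empty using (⊥-elim)
open import Data.Fin using (Fin; _<_)
import Data.Fin.Properties as Fin
open import Data.List using (List; []; _∷_; length; filter; map; concatMap; _++_; cartesianProductWith; cartesianProduct; allFin)
open import Data.List.Membership.Propositional using (_∈_; _∉_; find)
open import Data.List.Membership.Propositional.Properties
open import Data.List.Properties using (length-++; length-map; length-tabulate; filter-none)
open import Data.List.Relation.Binary.Disjoint.Propositional using (Disjoint)
open import Data.List.Relation.Binary.Subset.Propositional using (_⊆_)
open import Data.List.Relation.Unary.All as All using (All; []; _∷_)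
import Data.List.Relation.Unary.All.Properties as All
open import Data.List.Relation.Unary.AllPairs as AllPairs using ([]; _∷_)
import Data.List.Relation.Unary.AllPairs.Properties as AllPairs
open import Data.List.Relation.Unary.Any as Any using (here; there)
open import Data.List.Relation.Unary.Unique.Propositional using (Unique)
import Data.List.Relation.Unary.Unique.Propositional.Properties as Unique
open import Data.Nat using (ℕ; zero; suc; _+_; _*_; _^_; _∸_; _≤_; z≤n; s≤s; NonZero; >-nonZero)
open import Data.Nat.ListAction using (sum)
open import Data.Nat.Properties
open import Algebra.Properties.CommutativeSemigroup *-commutativeSemigroup using (x∙yz≈y∙xz)
open import Data.Nat.Tactic.RingSolver using (solve-∀)
open import Data.Product as Product using (_×_; _,_; proj₁; proj₂; ∃)
open import Data.Sum as Sum using (_⊎_; inj₁; inj₂; [_,_]′)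
open import Data.Vec using (Vec; []; _∷_; tabulate; lookup)
import Data.Vec.Properties as Vec
open import Function using (_∘_; id)
open import Relation.Binary.Definitions using (DecidableEquality)
open import Relation.Binary.PropositionalEquality
open import Relation.Nullary using (¬_; yes; no)
open import Relation.Nullary.Decidable using (_×-dec_)
open import Relation.Unary using (Decidable)
open import Relation.Unary.Properties using (∁?)

open import Defs

Unique⇒⊆⇒length≤ : ∀ {A : Set} {xs ys : List A} → Unique xs → xs ⊆ ys → length xs ≤ length ys
Unique⇒⊆⇒length≤ [] _ = z≤n
Unique⇒⊆⇒length≤ {xs = x ∷ xs} {ys} (x∉xs ∷ xs!) xs⊆ys with ∈-∃++ (xs⊆ys (here refl))
... | ys₁ , ys₂ , refl = begin
    suc (length xs)                 ≤⟨ s≤s (Unique⇒⊆⇒length≤ xs! xs⊆ys₁++ys₂) ⟩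
    suc (length (ys₁ ++ ys₂))       ≡⟨ cong suc (length-++ ys₁) ⟩
    suc (length ys₁ + length ys₂)   ≡⟨ sym (+-suc (length ys₁) (length ys₂)) ⟩
    length ys₁ + length (x ∷ ys₂)   ≡⟨ sym (length-++ ys₁) ⟩
    length (ys₁ ++ x ∷ ys₂)         ∎
  where
  open ≤-Reasoning
  xs⊆ys₁++ys₂ : xs ⊆ ys₁ ++ ys₂
  xs⊆ys₁++ys₂ {y} y∈xs with ∈-++⁻ ys₁ (xs⊆ys (there y∈xs))
  ... | inj₁ y∈ys₁        = ∈-++⁺ˡ y∈ys₁
  ... | inj₂ (here refl)  = ⊥-elim (All.lookup x∉xs y∈xs refl)
  ... | inj₂ (there y∈ys₂) = ∈-++⁺ʳ ys₁ y∈ys₂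

concatMap-unique : ∀ {K A : Set} (F : K → List A) (g : A → K) →
  (∀ {k a} → a ∈ F k → g a ≡ k) → (∀ k → Unique (F k)) →
  ∀ {ks} → Unique ks → Unique (concatMap F ks)
concatMap-unique F g g-fibre F! ks! = Unique.concat⁺
  (All.map⁺ (All.universal F! _))
  (AllPairs.map⁺ {f = F} (AllPairs.map disjoint ks!))
  where
  disjoint : ∀ {k k′} → k ≢ k′ → Disjoint (F k) (F k′)
  disjoint k≢k′ (a∈Fk , a∈Fk′) = k≢k′ (trans (sym (g-fibre a∈Fk)) (g-fibre a∈Fk′))

length-concatMap : ∀ {A B : Set} (f : A → List B) xs → length (concatMap f xs) ≡ sum (map (length ∘ f) xs)
length-concatMap f []       = refl
length-concatMap f (x ∷ xs) = trans (length-++ (f x)) (cong (length (f x) +_) (length-concatMap f xs))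

length-filter+length-filter-∁ : ∀ {A : Set} {P : A → Set} (P? : Decidable P) xs →
  length (filter P? xs) + length (filter (∁? P?) xs) ≡ length xs
length-filter+length-filter-∁ P? []       = refl
length-filter+length-filter-∁ P? (x ∷ xs) with P? x
... | yes _ = cong suc (length-filter+length-filter-∁ P? xs)
... | no  _ = trans (+-suc _ _) (cong suc (length-filter+length-filter-∁ P? xs))

concatMap-map≡cartesianProductWith : ∀ {A B C : Set} (f : A → B → C) xs ys →
  concatMap (λ x → map (f x) ys) xs ≡ cartesianProductWith f xs ys
concatMap-map≡cartesianProductWith f []       ys = refl
concatMap-map≡cartesianProductWith f (x ∷ xs) ys = cong (map (f x) ys ++_) (concatMap-map≡cartesianProductWith f xs ys)

length-cartesianProductWith : ∀ {A B C : Set} (f : A → B → C) xs ys →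
  length (cartesianProductWith f xs ys) ≡ length xs * length ys
length-cartesianProductWith f []       ys = refl
length-cartesianProductWith f (x ∷ xs) ys = trans (length-++ (map (f x) ys))
  (cong₂ _+_ (length-map (f x) ys) (length-cartesianProductWith f xs ys))

length-cartesianProduct-allFin : ∀ m n → length (cartesianProduct (allFin m) (allFin n)) ≡ m * n
length-cartesianProduct-allFin m n = trans (length-cartesianProductWith _,_ (allFin m) (allFin n))
  (cong₂ _*_ (length-tabulate {n = m} id) (length-tabulate {n = n} id))

sum-map-≥ : ∀ {A : Set} (f : A → ℕ) {b} xs → (∀ {x} → x ∈ xs → b ≤ f x) → length xs * b ≤ sum (map f xs)
sum-map-≥ f []       _     = z≤n
sum-map-≥ f (x ∷ xs) b≤f = +-mono-≤ (b≤f (here refl)) (sum-map-≥ f xs (b≤f ∘ there))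

sum-map-*-≤ : ∀ {A : Set} (f : A → ℕ) {c b} xs → (∀ {x} → x ∈ xs → f x * c ≤ b) →
  sum (map f xs) * c ≤ length xs * b
sum-map-*-≤ f []       _     = z≤n
sum-map-*-≤ f {c} {b} (x ∷ xs) f*c≤b = begin
  (f x + sum (map f xs)) * c    ≡⟨ *-distribʳ-+ c (f x) _ ⟩
  f x * c + sum (map f xs) * c  ≤⟨ +-mono-≤ (f*c≤b (here refl)) (sum-map-*-≤ f xs (f*c≤b ∘ there)) ⟩
  b + length xs * b             ∎
  where open ≤-Reasoning

^-distribʳ-* : ∀ m n o → (m * n) ^ o ≡ m ^ o * n ^ o
^-distribʳ-* m n zero    = refl
^-distribʳ-* m n (suc o) = trans (cong (m * n *_) (^-distribʳ-* m n o)) (interchange m n (m ^ o) (n ^ o))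
  where
  interchange : ∀ a b c d → a * b * (c * d) ≡ a * c * (b * d)
  interchange = solve-∀

m≤2[m∸n] : ∀ m n → 2 * n ≤ m → m ≤ 2 * (m ∸ n)
m≤2[m∸n] m n 2n≤m = begin
  m                    ≡⟨ sym (m+[n∸m]≡n n≤m) ⟩
  n + (m ∸ n)          ≤⟨ +-monoˡ-≤ (m ∸ n) (m+n≤o⇒m≤o∸n n (subst (_≤ m) (cong (n +_) (+-identityʳ n)) 2n≤m)) ⟩
  (m ∸ n) + (m ∸ n)    ≡⟨ cong ((m ∸ n) +_) (sym (+-identityʳ (m ∸ n))) ⟩
  2 * (m ∸ n)          ∎
  where
  open ≤-Reasoning
  n≤m : n ≤ m
  n≤m = ≤-trans (m≤m+n n (n + 0)) 2n≤m

module _ {A : Set} where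

  allVec-suc : ∀ (xs : List A) k → allVec xs (suc k) ≡ cartesianProductWith _∷_ xs (allVec xs k)
  allVec-suc xs k = concatMap-map≡cartesianProductWith _∷_ xs (allVec xs k)

  allVec-unique : ∀ {xs : List A} → Unique xs → ∀ k → Unique (allVec xs k)
  allVec-unique xs! zero    = All.[] ∷ []
  allVec-unique {xs} xs! (suc k) = subst Unique (sym (allVec-suc xs k))
    (Unique.cartesianProductWith⁺ _∷_ Vec.∷-injective xs! (allVec-unique xs! k))

  ∈-allVec : ∀ {xs : List A} → (∀ x → x ∈ xs) → ∀ {k} (v : Vec A k) → v ∈ allVec xs k
  ∈-allVec ∈xs []            = here refl
  ∈-allVec {xs} ∈xs {suc k} (x ∷ v) = subst (_ ∈_) (sym (allVec-suc xs k))
    (∈-cartesianProductWith⁺ _∷_ (∈xs x) (∈-allVec ∈xs v))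

  length-allVec : ∀ (xs : List A) k → length (allVec xs k) ≡ length xs ^ k
  length-allVec xs zero    = refl
  length-allVec xs (suc k) = begin
    length (allVec xs (suc k))                           ≡⟨ cong length (allVec-suc xs k) ⟩
    length (cartesianProductWith _∷_ xs (allVec xs k))   ≡⟨ length-cartesianProductWith _∷_ xs (allVec xs k) ⟩
    length xs * length (allVec xs k)                     ≡⟨ cong (length xs *_) (length-allVec xs k) ⟩
    length xs ^ suc k                                    ∎
    where open ≡-Reasoning

module Counting {A : Set} (xs : List A) (xs! : Unique xs) (∈xs : ∀ x → x ∈ xs) where

  count : {P : A → Set} → Decidable P → ℕ
  count P? = length (filter P? xs)

  module _ {P Q : A → Set} (P? : Decidable P) (Q? : Decidable Q) where

    count-≤-injection : (f : A → A) → (∀ {x y} → f x ≡ f y → x ≡ y) → (∀ {x} → P x → Q (f x)) →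
      count P? ≤ count Q?
    count-≤-injection f f-injective P⇒Q∘f = subst (_≤ count Q?) (length-map f (filter P? xs))
      (Unique⇒⊆⇒length≤ (Unique.map⁺ f-injective (Unique.filter⁺ P? xs!)) image⊆)
      where
      image⊆ : map f (filter P? xs) ⊆ filter Q? xs
      image⊆ y∈ with ∈-map⁻ f y∈
      ... | x , x∈ , refl = ∈-filter⁺ Q? (∈xs (f x)) (P⇒Q∘f (proj₂ (∈-filter⁻ P? {xs = xs} x∈)))

    count-mono : (∀ {x} → P x → Q x) → count P? ≤ count Q?
    count-mono = count-≤-injection id id

  count-empty : {P : A → Set} (P? : Decidable P) → (∀ {x} → ¬ P x) → count P? ≡ 0
  count-empty P? ¬P = cong length (filter-none P? (All.universal (λ _ → ¬P) xs))

  module _ {K : Set} {Q : K → A → Set} (Q? : ∀ k → Decidable (Q k)) where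

    count-≤-sum : {P : A → Set} (P? : Decidable P) (ks : List K) →
      (∀ {x} → P x → ∃ λ k → k ∈ ks × Q k x) → count P? ≤ sum (map (λ k → count (Q? k)) ks)
    count-≤-sum P? ks covered = subst (count P? ≤_) (length-concatMap (λ k → filter (Q? k) xs) ks)
      (Unique⇒⊆⇒length≤ (Unique.filter⁺ P? xs!) ⊆⋃)
      where
      ⊆⋃ : filter P? xs ⊆ concatMap (λ k → filter (Q? k) xs) ks
      ⊆⋃ x∈ with ∈-filter⁻ P? {xs = xs} x∈
      ... | x∈xs , Px with covered Px
      ... | k , k∈ks , Qkx =
        ∈-concatMap⁺ (λ k → filter (Q? k) xs) (Any.map (λ { refl → ∈-filter⁺ (Q? k) x∈xs Qkx }) k∈ks)

    sum-count-≤ : {R : A → Set} (R? : Decidable R) (g : A → K) {ks : List K} → Unique ks →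
      (∀ {k x} → Q k x → g x ≡ k) → (∀ {k x} → Q k x → R x) → sum (map (λ k → count (Q? k)) ks) ≤ count R?
    sum-count-≤ R? g {ks} ks! g-fibre Q⇒R = subst (_≤ count R?) (length-concatMap (λ k → filter (Q? k) xs) ks)
      (Unique⇒⊆⇒length≤ (concatMap-unique (λ k → filter (Q? k) xs) g
                            (g-fibre ∘ proj₂ ∘ ∈-filter⁻ (Q? _) {xs = xs}) (λ k → Unique.filter⁺ (Q? k) xs!) ks!)
                          ⋃⊆)
      where
      ⋃⊆ : concatMap (λ k → filter (Q? k) xs) ks ⊆ filter R? xs
      ⋃⊆ x∈ with find (∈-concatMap⁻ (λ k → filter (Q? k) xs) {xs = ks} x∈)
      ... | k , _ , x∈Qk with ∈-filter⁻ (Q? k) {xs = xs} x∈Qk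
      ... | x∈xs , Qkx = ∈-filter⁺ R? x∈xs (Q⇒R Qkx)

module _ {A : Set} (_≟_ : DecidableEquality A) where

  open import Data.List.Membership.DecPropositional _≟_ using (_∈?_)

  length∸length≤length-filter-∉ : ∀ {xs} → Unique xs → ∀ ys →
    length xs ∸ length ys ≤ length (filter (∁? (_∈? ys)) xs)
  length∸length≤length-filter-∉ {xs} xs! ys = m≤n+o⇒m∸n≤o (length xs) (length ys) (begin
    length xs                                     ≡⟨ sym (length-filter+length-filter-∁ (_∈? ys) xs) ⟩
    length (filter (_∈? ys) xs) + length outside  ≤⟨ +-monoˡ-≤ (length outside) inside≤ys ⟩
    length ys + length outside                    ∎)
    where
    open ≤-Reasoning
    outside : List A
    outside = filter (∁? (_∈? ys)) xs
    inside≤ys : length (filter (_∈? ys) xs) ≤ length ys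
    inside≤ys = Unique⇒⊆⇒length≤ (Unique.filter⁺ (_∈? ys) xs!) (proj₂ ∘ ∈-filter⁻ (_∈? ys) {xs = xs})

  module Transposition (a b : A) where

    transpose : A → A
    transpose x with x ≟ a
    ... | yes _ = b
    ... | no  _ with x ≟ b
    ...   | yes _ = a
    ...   | no  _ = x

    transpose-a : transpose a ≡ b
    transpose-a with a ≟ a
    ... | yes _   = refl
    ... | no  a≢a = ⊥-elim (a≢a refl)

    transpose-b : transpose b ≡ a
    transpose-b with b ≟ a
    ... | yes b≡a = b≡a
    ... | no  _ with b ≟ b
    ...   | yes _   = refl
    ...   | no  b≢b = ⊥-elim (b≢b refl)

    transpose-fixed : ∀ {x} → x ≢ a → x ≢ b → transpose x ≡ x
    transpose-fixed {x} x≢a x≢b with x ≟ a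
    ... | yes x≡a = ⊥-elim (x≢a x≡a)
    ... | no  _ with x ≟ b
    ...   | yes x≡b = ⊥-elim (x≢b x≡b)
    ...   | no  _   = refl

    transpose-involutive : ∀ x → transpose (transpose x) ≡ x
    transpose-involutive x with x ≟ a
    ... | yes refl = transpose-b
    ... | no  x≢a with x ≟ b
    ...   | yes refl = transpose-a
    ...   | no  x≢b  = transpose-fixed x≢a x≢b

    transpose-injective : ∀ {x y} → transpose x ≡ transpose y → x ≡ y
    transpose-injective {x} {y} eq = trans (sym (transpose-involutive x)) (trans (cong transpose eq) (transpose-involutive y))


module Pairings (n r : ℕ) where

  Constraint : Set
  Constraint = Point n r × Point n r

  Satisfies : List Constraint → Table n r → Set
  Satisfies c t = All (λ pq → app t (proj₁ pq) ≡ proj₂ pq) c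

  Constrained : List Constraint → Table n r → Set
  Constrained c t = IsPairing t × Satisfies c t

  constrained? : ∀ c → Decidable (Constrained c)
  constrained? c t = isPairing? t ×-dec All.all? (λ pq → app t (proj₁ pq) ≟P proj₂ pq) c

  endpoints : List Constraint → List (Point n r)
  endpoints []            = []
  endpoints ((p , q) ∷ c) = p ∷ q ∷ endpoints c

  length-endpoints : ∀ c → length (endpoints c) ≡ 2 * length c
  length-endpoints []      = refl
  length-endpoints (_ ∷ c) = cong suc (trans (cong suc (length-endpoints c)) (sym (+-suc _ _)))

  module _ (t : Table n r) (t-pairing : IsPairing t) where

    pairing-involutive : ∀ x → app t (app t x) ≡ x
    pairing-involutive (v , j) = proj₁ (t-pairing v j)

    pairing-fixedPointFree : ∀ x → app t x ≢ x
    pairing-fixedPointFree (v , j) = proj₂ (t-pairing v j)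

    endpoint-constrained : ∀ {c x} → Satisfies c t → x ∈ endpoints c → (x , app t x) ∈ c ⊎ (app t x , x) ∈ c
    endpoint-constrained {(p , q) ∷ c} (tp≡q ∷ _) (here refl) = inj₁ (here (cong (p ,_) tp≡q))
    endpoint-constrained {(p , q) ∷ c} (tp≡q ∷ _) (there (here refl)) =
      inj₂ (here (cong (_, q) (trans (cong (app t) (sym tp≡q)) (pairing-involutive p))))
    endpoint-constrained {_ ∷ c} (_ ∷ sat) (there (there x∈)) =
      Sum.map there there (endpoint-constrained sat x∈)

  module _ (a b : Point n r) where

    open Transposition _≟P_ a b

    conjugate : Table n r → Table n r
    conjugate t = tabulate λ v → tabulate λ j → transpose (app t (transpose (v , j)))

    app-conjugate : ∀ t x → app (conjugate t) x ≡ transpose (app t (transpose x))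
    app-conjugate t (v , j) = trans (cong (λ row → lookup row j) (Vec.lookup∘tabulate _ v)) (Vec.lookup∘tabulate _ j)

    conjugate-maps : ∀ t {x y} → app t x ≡ y → app (conjugate t) (transpose x) ≡ transpose y
    conjugate-maps t {x} {y} tx≡y = begin
      app (conjugate t) (transpose x)                ≡⟨ app-conjugate t (transpose x) ⟩
      transpose (app t (transpose (transpose x)))    ≡⟨ cong (transpose ∘ app t) (transpose-involutive x) ⟩
      transpose (app t x)                            ≡⟨ cong transpose tx≡y ⟩
      transpose y                                    ∎
      where open ≡-Reasoning

    conjugate-involutive : ∀ t → conjugate (conjugate t) ≡ t
    conjugate-involutive t = trans (Vec.tabulate-cong λ v → Vec.tabulate-cong λ j → entry (v , j))
      (trans (Vec.tabulate-cong λ v → Vec.tabulate∘lookup (lookup t v)) (Vec.tabulate∘lookup t))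
      where
      entry : ∀ x → transpose (app (conjugate t) (transpose x)) ≡ app t x
      entry x = trans (cong transpose (conjugate-maps t {x} refl)) (transpose-involutive (app t x))

    conjugate-injective : ∀ {t t′} → conjugate t ≡ conjugate t′ → t ≡ t′
    conjugate-injective {t} {t′} eq =
      trans (sym (conjugate-involutive t)) (trans (cong conjugate eq) (conjugate-involutive t′))

    conjugate-isPairing : ∀ t → IsPairing t → IsPairing (conjugate t)
    conjugate-isPairing t t-pairing v j =
        subst (λ x → app (conjugate t) (app (conjugate t) x) ≡ x) ττx≡x (involutive (transpose (v , j)))
      , subst (λ x → app (conjugate t) x ≢ x) ττx≡x (fixedPointFree (transpose (v , j)))
      where
      ττx≡x : transpose (transpose (v , j)) ≡ (v , j)
      ττx≡x = transpose-involutive (v , j)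
      involutive : ∀ y → app (conjugate t) (app (conjugate t) (transpose y)) ≡ transpose y
      involutive y = trans (cong (app (conjugate t)) (conjugate-maps t {y} refl))
        (conjugate-maps t (pairing-involutive t t-pairing y))
      fixedPointFree : ∀ y → app (conjugate t) (transpose y) ≢ transpose y
      fixedPointFree y eq = pairing-fixedPointFree t t-pairing y
        (transpose-injective (trans (sym (conjugate-maps t {y} refl)) eq))

    conjugate-satisfies : ∀ t c → (∀ {x} → x ∈ endpoints c → x ≢ a × x ≢ b) →
      Satisfies c t → Satisfies c (conjugate t)
    conjugate-satisfies t []            _      []           = []
    conjugate-satisfies t ((p , q) ∷ c) avoids (tp≡q ∷ sat) =
      subst₂ (λ x y → app (conjugate t) x ≡ y) (fixed (here refl)) (fixed (there (here refl))) (conjugate-maps t tp≡q)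
      ∷ conjugate-satisfies t c (avoids ∘ there ∘ there) sat
      where
      fixed : ∀ {x} → x ∈ endpoints ((p , q) ∷ c) → transpose x ≡ x
      fixed x∈ = transpose-fixed (proj₁ (avoids x∈)) (proj₂ (avoids x∈))

  allPoints-unique : Unique (allPoints n r)
  allPoints-unique = Unique.cartesianProduct⁺ (Unique.allFin⁺ n) (Unique.allFin⁺ r)

  ∈-allPoints : ∀ x → x ∈ allPoints n r
  ∈-allPoints (v , j) = ∈-cartesianProduct⁺ (∈-allFin v) (∈-allFin j)

  open Counting (allTables n r) (allVec-unique (allVec-unique allPoints-unique r) n)
                                (∈-allVec (∈-allVec ∈-allPoints))
  open import Data.List.Membership.DecPropositional (_≟P_ {n} {r}) using (_∈?_)

  count-clash : ∀ c {p q} → (p , q) ∉ c → (q , p) ∉ c → q ∈ endpoints c →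
    count (constrained? ((p , q) ∷ c)) ≡ 0
  count-clash c {p} {q} pq∉c qp∉c q∈ = count-empty (constrained? ((p , q) ∷ c)) (λ {t} → clash t)
    where
    clash : ∀ t → ¬ Constrained ((p , q) ∷ c) t
    clash t (t-pairing , tp≡q ∷ sat) =
      [ qp∉c ∘ subst (λ x → (q , x) ∈ c) tq≡p , pq∉c ∘ subst (λ x → (x , q) ∈ c) tq≡p ]′
        (endpoint-constrained t t-pairing sat q∈)
      where
      tq≡p : app t q ≡ p
      tq≡p = trans (cong (app t) (sym tp≡q)) (pairing-involutive t t-pairing p)

  switching : ∀ c {p q} → p ≢ q → q ∉ endpoints c →
    count (constrained? ((p , q) ∷ c)) * (n * r ∸ length (p ∷ endpoints c)) ≤ count (constrained? c)
  switching c {p} {q} p≢q q∉ = begin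
    count[pq] * (n * r ∸ length used)   ≤⟨ *-monoʳ-≤ count[pq] free-size ⟩
    count[pq] * length free             ≡⟨ *-comm count[pq] (length free) ⟩
    length free * count[pq]             ≤⟨ sum-map-≥ (λ k → count (constrained? ((p , k) ∷ c))) free count[pq]≤count[pk] ⟩
    sum (map (λ k → count (constrained? ((p , k) ∷ c))) free)
      ≤⟨ sum-count-≤ (λ k → constrained? ((p , k) ∷ c)) (constrained? c) (λ t → app t p)
           (Unique.filter⁺ (∁? (_∈? used)) allPoints-unique) (All.head ∘ proj₂) (Product.map₂ All.tail) ⟩
    count (constrained? c)              ∎
    where
    open ≤-Reasoning
    count[pq] : ℕ
    count[pq] = count (constrained? ((p , q) ∷ c))
    used : List (Point n r)
    used = p ∷ endpoints c
    free : List (Point n r)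
    free = filter (∁? (_∈? used)) (allPoints n r)
    free-size : n * r ∸ length used ≤ length free
    free-size = subst (λ N → N ∸ length used ≤ length free) (length-cartesianProduct-allFin n r)
      (length∸length≤length-filter-∉ _≟P_ allPoints-unique used)
    count[pq]≤count[pk] : ∀ {k} → k ∈ free → count[pq] ≤ count (constrained? ((p , k) ∷ c))
    count[pq]≤count[pk] {k} k∈free = count-≤-injection (constrained? ((p , q) ∷ c)) (constrained? ((p , k) ∷ c))
      (conjugate q k) (conjugate-injective q k) (λ {t} → switch t)
      where
      open Transposition _≟P_ q k
      k∉used : k ∉ used
      k∉used = proj₂ (∈-filter⁻ (∁? (_∈? used)) {xs = allPoints n r} k∈free)
      switch : ∀ t → Constrained ((p , q) ∷ c) t → Constrained ((p , k) ∷ c) (conjugate q k t)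
      switch t (t-pairing , tp≡q ∷ sat) = conjugate-isPairing q k t t-pairing
        , subst₂ (λ x y → app (conjugate q k t) x ≡ y) (transpose-fixed p≢q (λ { refl → k∉used (here refl) })) transpose-a
                 (conjugate-maps q k t tp≡q)
        ∷ conjugate-satisfies q k t c (λ x∈ → (λ { refl → q∉ x∈ }) , (λ { refl → k∉used (there x∈) })) sat

  extend-constraint : ∀ c {p q} → p ≢ q → (p , q) ∉ c → (q , p) ∉ c → 4 * suc (length c) ≤ n * r →
    count (constrained? ((p , q) ∷ c)) * (n * r) ≤ 2 * count (constrained? c)
  extend-constraint c {p} {q} p≢q pq∉c qp∉c room with q ∈? endpoints c
  ... | yes q∈ = subst (λ k → k * (n * r) ≤ 2 * count (constrained? c)) (sym (count-clash c pq∉c qp∉c q∈)) z≤n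
  ... | no  q∉ = begin
    count[pq] * (n * r)                         ≤⟨ *-monoʳ-≤ count[pq] (m≤2[m∸n] (n * r) (length used) half-room) ⟩
    count[pq] * (2 * (n * r ∸ length used))     ≡⟨ x∙yz≈y∙xz count[pq] 2 _ ⟩
    2 * (count[pq] * (n * r ∸ length used))     ≤⟨ *-monoʳ-≤ 2 (switching c p≢q q∉) ⟩
    2 * count (constrained? c)                  ∎
    where
    open ≤-Reasoning
    count[pq] : ℕ
    count[pq] = count (constrained? ((p , q) ∷ c))
    used : List (Point n r)
    used = p ∷ endpoints c
    half-room : 2 * length used ≤ n * r
    half-room = ≤-trans (≤-reflexive (cong (λ e → 2 * suc e) (length-endpoints c)))
      (≤-trans (2[1+2k]≤4[1+k] (length c)) room)
      where
      identity : ∀ k → 2 * suc (2 * k) + 2 ≡ 4 * suc k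
      identity = solve-∀
      2[1+2k]≤4[1+k] : ∀ k → 2 * suc (2 * k) ≤ 4 * suc k
      2[1+2k]≤4[1+k] k = subst (2 * suc (2 * k) ≤_) (identity k) (m≤m+n _ 2)

  constraints : (E : List (Fin n × Fin n)) → Vec (Fin r × Fin r) (length E) → List Constraint
  constraints []            []              = []
  constraints ((u , v) ∷ E) ((j , j′) ∷ js) = ((u , j) , (v , j′)) ∷ constraints E js

  length-constraints : ∀ E js → length (constraints E js) ≡ length E
  length-constraints []      []       = refl
  length-constraints (_ ∷ E) (_ ∷ js) = cong suc (length-constraints E js)

  ∈-constraints⁻ : ∀ E js {u j v j′} → ((u , j) , (v , j′)) ∈ constraints E js → (u , v) ∈ E
  ∈-constraints⁻ []      []       ()
  ∈-constraints⁻ (_ ∷ E) (_ ∷ js) (here refl) = here refl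
  ∈-constraints⁻ (_ ∷ E) (_ ∷ js) (there x∈)  = there (∈-constraints⁻ E js x∈)

  contains⇒satisfies-constraints : ∀ E t → Contains E t → ∃ λ js → Satisfies (constraints E js) t
  contains⇒satisfies-constraints []            _ []                        = [] , []
  contains⇒satisfies-constraints ((u , v) ∷ E) t ((j , tuj∈v) ∷ contains) =
    let js , sat = contains⇒satisfies-constraints E t contains
    in (j , proj₂ (app t (u , j))) ∷ js , cong (_, proj₂ (app t (u , j))) tuj∈v ∷ sat

  count-constraints : ∀ E js → All (λ e → proj₁ e < proj₂ e) E → Unique E → 4 * length E ≤ n * r →
    count (constrained? (constraints E js)) * (n * r) ^ length E ≤ 2 ^ length E * numPairings n r
  count-constraints [] [] _ _ _ = begin
    count (constrained? []) * 1   ≡⟨ *-identityʳ _ ⟩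
    count (constrained? [])       ≤⟨ count-mono (constrained? []) isPairing? proj₁ ⟩
    numPairings n r               ≡⟨ sym (+-identityʳ _) ⟩
    1 * numPairings n r           ∎
    where open ≤-Reasoning
  count-constraints ((u , v) ∷ E) ((j , j′) ∷ js) (u<v ∷ ordered) (uv∉E ∷ E!) room = begin
    count[pq] * (N * N ^ m)                ≡⟨ sym (*-assoc count[pq] N _) ⟩
    count[pq] * N * N ^ m                  ≤⟨ *-monoˡ-≤ (N ^ m) (extend-constraint c p≢q pq∉c qp∉c room′) ⟩
    2 * count (constrained? c) * N ^ m     ≡⟨ *-assoc 2 (count (constrained? c)) (N ^ m) ⟩
    2 * (count (constrained? c) * N ^ m)   ≤⟨ *-monoʳ-≤ 2 (count-constraints E js ordered E! room-E) ⟩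
    2 * (2 ^ m * numPairings n r)          ≡⟨ sym (*-assoc 2 (2 ^ m) (numPairings n r)) ⟩
    2 ^ suc m * numPairings n r            ∎
    where
    open ≤-Reasoning
    N : ℕ
    N = n * r
    m : ℕ
    m = length E
    c : List Constraint
    c = constraints E js
    p : Point n r
    p = (u , j)
    q : Point n r
    q = (v , j′)
    count[pq] : ℕ
    count[pq] = count (constrained? ((p , q) ∷ c))
    p≢q : p ≢ q
    p≢q = Fin.<⇒≢ u<v ∘ cong proj₁
    pq∉c : (p , q) ∉ c
    pq∉c pq∈c = All.lookup uv∉E (∈-constraints⁻ E js pq∈c) refl
    qp∉c : (q , p) ∉ c
    qp∉c qp∈c = Fin.<-asym u<v (All.lookup ordered (∈-constraints⁻ E js qp∈c))
    room-E : 4 * m ≤ N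
    room-E = ≤-trans (*-monoʳ-≤ 4 (n≤1+n m)) room
    room′ : 4 * suc (length c) ≤ N
    room′ = subst (λ k → 4 * suc k ≤ N) (sym (length-constraints E js)) room

  count-containing : ∀ E → All (λ e → proj₁ e < proj₂ e) E → Unique E → 4 * length E ≤ n * r →
    numPairingsContaining n r E * (n * r) ^ length E ≤ (r * r) ^ length E * (2 ^ length E * numPairings n r)
  count-containing E ordered E! room = begin
    count (pairingAndContains? E) * N ^ m                         ≤⟨ *-monoˡ-≤ (N ^ m) union-bound ⟩
    sum (map (λ js → count (constrained? (constraints E js))) allChoices) * N ^ m
      ≤⟨ sum-map-*-≤ _ allChoices (λ {js} _ → count-constraints E js ordered E! room) ⟩
    length allChoices * (2 ^ m * numPairings n r)
      ≡⟨ cong (_* (2 ^ m * numPairings n r)) length-allChoices ⟩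
    (r * r) ^ m * (2 ^ m * numPairings n r)                       ∎
    where
    open ≤-Reasoning
    N : ℕ
    N = n * r
    m : ℕ
    m = length E
    choices : List (Fin r × Fin r)
    choices = cartesianProduct (allFin r) (allFin r)
    allChoices : List (Vec (Fin r × Fin r) m)
    allChoices = allVec choices m
    union-bound : count (pairingAndContains? E) ≤ sum (map (λ js → count (constrained? (constraints E js))) allChoices)
    union-bound = count-≤-sum (λ js → constrained? (constraints E js)) (pairingAndContains? E) allChoices
      λ {t} (t-pairing , contains) → let js , sat = contains⇒satisfies-constraints E t contains
        in js , ∈-allVec (λ (j , j′) → ∈-cartesianProduct⁺ (∈-allFin j) (∈-allFin j′)) js , t-pairing , sat
    length-allChoices : length allChoices ≡ (r * r) ^ m
    length-allChoices = trans (length-allVec choices m) (cong (_^ m) (length-cartesianProduct-allFin r r))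

lemma12 : (r n : ℕ) → 3 ≤ r → (∃ λ k → r * n ≡ 2 * k) →
    (E0 : List (Fin n × Fin n)) →
    All (λ e → proj₁ e < proj₂ e) E0 → Unique E0 →
    4 * length E0 ≤ n * r →
    numPairingsContaining n r E0 * n ^ length E0
      ≤ 2 * (2 * r) ^ length E0 * numPairings n r
lemma12 r n 3≤r _ E0 ordered E0! room = ≤-trans cancelled (*-monoˡ-≤ Y (m≤m+n ((2 * r) ^ m) _))
  where
  open Pairings n r using (count-containing)
  m : ℕ
  m = length E0
  X : ℕ
  X = numPairingsContaining n r E0
  Y : ℕ
  Y = numPairings n r
  instance
    r≢0 : NonZero r
    r≢0 = >-nonZero (≤-trans (s≤s z≤n) 3≤r)
  cancelled : X * n ^ m ≤ (2 * r) ^ m * Y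
  cancelled = *-cancelˡ-≤ (r ^ m) {{m^n≢0 r m}} (begin
    r ^ m * (X * n ^ m)          ≡⟨ x∙yz≈y∙xz (r ^ m) X (n ^ m) ⟩
    X * (r ^ m * n ^ m)          ≡⟨ cong (X *_) (trans (*-comm (r ^ m) _) (sym (^-distribʳ-* n r m))) ⟩
    X * (n * r) ^ m              ≤⟨ count-containing E0 ordered E0! room ⟩
    (r * r) ^ m * (2 ^ m * Y)    ≡⟨ cong (_* (2 ^ m * Y)) (^-distribʳ-* r r m) ⟩
    r ^ m * r ^ m * (2 ^ m * Y)  ≡⟨ rearrange (r ^ m) (2 ^ m) Y ⟩
    r ^ m * (2 ^ m * r ^ m * Y)  ≡⟨ cong (λ z → r ^ m * (z * Y)) (sym (^-distribʳ-* 2 r m)) ⟩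
    r ^ m * ((2 * r) ^ m * Y)    ∎)
    where
    open ≤-Reasoning
    rearrange : ∀ a b y → a * a * (b * y) ≡ a * (b * a * y)
    rearrange = solve-∀
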